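{- Let $(U,\varphi)$ be a finite standard closure space whose lattice of closed sets is modular. Then the (aggregated) $E$-base of $(U,\varphi)$ is valid if and only if for every non-join-irreducible essential set $C$ and every predecessor $C'$ of $C$ one has $|C'\setminus C_*|=1$, where $C_*$ is the intersection of all predecessors of $C$.
   Context: A closure space $(U,\varphi)$ is a finite set $U$ with a closure operator $\varphi$ on $2^U$; closed sets $\mathcal{C}=\{C:\varphi(C)=C\}$ form a lattice under inclusion (join $\varphi(C_1\cup C_2)$, meet $\cap$). Standard: $\varphi(\{x\})\setminus\{x\}$ is closed for all $x\in U$. A predecessor of a closed set $C$ is a closed $C'\subsetneq C$ with no closed set strictly between; $C$ is join-irreducible if it has exactly one predecessor. A set $Q\subseteq U$ is quasi-closed if for every $X\subseteq Q$ with $\varphi(X)\subsetneq\varphi(Q)$ we have $\varphi(X)\subseteq Q$; $P$ is pseudo-closed if $P$ is not closed and is inclusion-minimal among quasi-closed sets $Q$ with $\varphi(Q)=\varphi(P)$; a closed set is essential if it equals $\varphi(P)$ for some pseudo-closed $P$. Binary part: $\varphi^b(X)=\bigcup_{x\in X}\varphi(\{x\})$. A $D$-generator of $x$ is $A\subseteq U$ with $x\in\varphi(A)$, $x\notin\varphi^b(A)$, and $x\notin\varphi(B)$ whenever $\varphi^b(B)\subsetneq\varphi^b(A)$; an $E$-generator of $x$ is a $D$-generator $A$ of $x$ with $\varphi(A)$ inclusion-minimal among closures of $D$-generators of $x$. Implications $A\to X$; a set $\Sigma$ of them induces the closure operator whose closed sets $C$ satisfy: $A\subseteq C\Rightarrow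 X\subseteq C$ for all $A\to X\in\Sigma$. The $E$-base is $\Sigma_E=\{a\to x: x\neq a, x\in\varphi(\{a\})\}\cup\{A\to x: A \text{ an } E\text{ -generator of } x\}$ (aggregated: implications with equal premises merged); it is valid if its induced closure operator equals $\varphi$. -}

module Defs where

open import Data.Nat using (ℕ)
open import Data.Fin using (Fin)
open import Data.Fin.Subset
open import Data.Fin.Subset.Properties using (_∈?_)
open import Data.List using (List; map; filter; allFin)
open import Data.Product using (Σ; ∃; _×_; _,_)
open import Data.Sum using (_⊎_)
open import Relation.Nullary using (¬_)
open import Relation.Binary.PropositionalEquality using (_≡_; _≢_)

record ClosureOperator (n : ℕ) : Set where
  field
    φ          : Subset n → Subset n
    extensive  : ∀ X → X ⊆ φ X
    monotone   : ∀ X Y → X ⊆ Y → φ X ⊆ φ Y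
    idempotent : ∀ X → φ (φ X) ≡ φ X

module _ {n : ℕ} (cl : ClosureOperator n) where
  open ClosureOperator cl

  Closed : Subset n → Set
  Closed C = φ C ≡ C

  Standard : Set
  Standard = ∀ x → Closed (φ ⁅ x ⁆ ─ ⁅ x ⁆)

  -- the lattice of closed sets (join φ(A ∪ B), meet A ∩ B) is modular:
  -- for closed A, B, C with A ≤ C:  A ∨ (B ∧ C) = (A ∨ B) ∧ C
  ModularClosedLattice : Set
  ModularClosedLattice =
    ∀ A B C → Closed A → Closed B → Closed C → A ⊆ C →
    φ (A ∪ (B ∩ C)) ≡ φ (A ∪ B) ∩ C

  Predecessor : Subset n → Subset n → Set
  Predecessor C' C =
    Closed C × Closed C' × C' ⊂ C ×
    (∀ D → Closed D → C' ⊂ D → ¬ (D ⊂ C))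

  JoinIrreducible : Subset n → Set
  JoinIrreducible C =
    Closed C × (∃ λ C' → Predecessor C' C × (∀ D → Predecessor D C → D ≡ C'))

  IsPredIntersection : Subset n → Subset n → Set
  IsPredIntersection C S =
    ∀ x → (x ∈ S → ∀ D → Predecessor D C → x ∈ D) ×
          ((∀ D → Predecessor D C → x ∈ D) → x ∈ S)

  QuasiClosed : Subset n → Set
  QuasiClosed Q = ∀ X → X ⊆ Q → φ X ⊂ φ Q → φ X ⊆ Q

  PseudoClosed : Subset n → Set
  PseudoClosed P =
    ¬ Closed P × QuasiClosed P ×
    (∀ Q → QuasiClosed Q → φ Q ≡ φ P → ¬ (Q ⊂ P))

  Essential : Subset n → Set
  Essential C = Closed C × (∃ λ P → PseudoClosed P × φ P ≡ C)

  φᵇ : Subset n → Subset n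
  φᵇ X = ⋃ (map (λ x → φ ⁅ x ⁆) (filter (λ x → x ∈? X) (allFin n)))

  DGenerator : Subset n → Fin n → Set
  DGenerator A x =
    x ∈ φ A × x ∉ φᵇ A × (∀ B → φᵇ B ⊂ φᵇ A → x ∉ φ B)

  EGenerator : Subset n → Fin n → Set
  EGenerator A x =
    DGenerator A x × (∀ B → DGenerator B x → ¬ (φ B ⊂ φ A))

  -- C is closed for (respects) every implication of the E-base
  -- (aggregation of premises does not change the set of closed sets)
  EBaseClosed : Subset n → Set
  EBaseClosed C =
    (∀ a x → x ≢ a → x ∈ φ ⁅ a ⁆ → a ∈ C → x ∈ C) ×
    (∀ A x → EGenerator A x → A ⊆ C → x ∈ C)

  -- the closure operator induced by the E-base equals φ:
  -- for every X, φ X is the least E-base-closed superset of X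
  EBaseValid : Set
  EBaseValid =
    ∀ X → (X ⊆ φ X × EBaseClosed (φ X)) ×
          (∀ C → X ⊆ C → EBaseClosed C → φ X ⊆ C)

-- Write C⁎ for the intersection of the predecessors of a closed set C.  Modularity makes
-- the meet of two distinct predecessors of C a lower cover of each of them, and is used
-- throughout in the form φ(A ∪ (B ∩ D)) = D for closed A ⊆ D ⊆ φ(A ∪ B).
--
-- (⇐) If some E-base-closed Y were not closed, pick Z ⊆ Y with φZ ⊈ Y and |φZ| minimal.
-- Then P = φZ ∩ Y is quasi-closed but not closed, so C = φP is essential; it is not
-- join-irreducible because P is closed under the binary implications.  A point of C ∖ C⁎
-- outside P would have a D-generator inside P, which is an E-generator because each
-- predecessor has a single point outside C⁎; so C ∖ C⁎ ⊆ P.  The points x₁, x₂ of two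
-- predecessors C₁, C₂ outside C⁎ generate C, hence C₁ = φ(φx₁ ∪ (φx₂ ∩ C₁)) ⊆ P, and C ⊆ P.
--
-- (⇒) Let C = φP with P pseudo-closed.  A maximal closed subset of P yields two
-- predecessors of C inside P, and a point of C ∖ P a third one outside; this forces
-- C⁎ = C' ∩ C_b for some predecessor C_b ≠ C', so C⁎ is a lower cover of C'.  If C' ∖ C⁎
-- had two points x ≠ z they would be incomparable, and C ∖ (C' ∖ C⁎) would be closed under
-- the E-base: an E-generator A of x with φA = C is undercut by a D-generator of x whose
-- closure lies in φ(C⁎ ∪ {z}) ⊆ C'.  Yet C ∖ (C' ∖ C⁎) contains two predecessors of C,
-- so it is not closed.

{-# OPTIONS --safe #-}
module Submission where

open import Defs
open import Data.Bool using () renaming (_≟_ to _≟ᵇ_)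
open import Data.Empty using (⊥)
open import Data.Fin using (Fin; zero; suc; _≟_)
open import Data.Fin.Properties using (¬∀⟶∃¬)
open import Data.Fin.Subset renaming (⊥ to ∅)
open import Data.Fin.Subset.Properties
open import Data.List using (List; []; _∷_; allFin)
open import Data.List.Membership.Propositional using () renaming (_∈_ to _∈ₗ_)
open import Data.List.Membership.Propositional.Properties using (∈-map⁺; ∈-map⁻; ∈-filter⁺; ∈-filter⁻; ∈-allFin)
import Data.List.Relation.Unary.Any as Any
open import Data.Nat using (ℕ; _<_)
open import Data.Nat.Induction using (<-wellFounded)
import Data.Nat.Properties as ℕ
open import Data.Product using (∃; ∃₂; _×_; _,_; proj₁; proj₂)
open import Data.Sum using (inj₁; inj₂)
open import Data.Vec using ([]; _∷_; here; there)
open import Data.Vec.Properties using (≡-dec)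
open import Effect.Monad using (RawMonad)
open import Function.Base using (_∘_)
open import Function.Bundles using (_⇔_; mk⇔)
open import Induction.WellFounded using (module All)
open import Level using (0ℓ)
import Relation.Binary.Construct.On as On
open import Relation.Binary.Definitions using (DecidableEquality)
open import Relation.Binary.PropositionalEquality
import Relation.Binary.Reasoning.PartialOrder as PosetReasoning
open import Relation.Nullary using (¬_; Dec; does; yes; no)
open import Relation.Nullary.Decidable using (decidable-stable; ¬¬-excluded-middle; _→-dec_)
open import Relation.Nullary.Negation using (¬¬-Monad; contradiction)

open RawMonad (¬¬-Monad {a = 0ℓ})

private
  ¬¬_ : Set → Set
  ¬¬ A = ¬ ¬ A

-- Classical reasoning over finite sets

module _ {A : Set} where

  ¬¬-minimiser : (μ : A → ℕ) {P : A → Set} {a : A} → P a →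
                 ¬¬ (∃ λ z → P z × ∀ z' → P z' → ¬ μ z' < μ z)
  ¬¬-minimiser μ {P} pa none = All.wfRec (On.wellFounded μ <-wellFounded) 0ℓ (λ z → ¬ P z) step _ pa
    where
    step : ∀ z → (∀ {z'} → μ z' < μ z → ¬ P z') → ¬ P z
    step z ih pz = none (z , pz , λ z' pz' lt → ih lt pz')

module _ {A : Set} (_≟ᴬ_ : DecidableEquality A) {R : A → Set} where

  two-avoiding : {a b c : A} → R a → R b → R c → a ≢ b → a ≢ c → b ≢ c →
                 ∀ d → ∃₂ λ u v → R u × R v × u ≢ v × u ≢ d × v ≢ d
  two-avoiding {a} {b} {c} Ra Rb Rc a≢b a≢c b≢c d with a ≟ᴬ d | b ≟ᴬ d
  ... | yes refl | _        = b , c , Rb , Rc , b≢c , a≢b ∘ sym , a≢c ∘ sym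
  ... | no a≢d   | yes refl = a , c , Ra , Rc , a≢c , a≢d , b≢c ∘ sym
  ... | no a≢d   | no b≢d   = a , b , Ra , Rb , a≢b , a≢d , b≢d

x∈p─q⇒x∉q : ∀ {n} (p q : Subset n) {x : Fin n} → x ∈ p ─ q → x ∉ q
x∈p─q⇒x∉q (s ∷ p) (outside ∷ q) here ()
x∈p─q⇒x∉q (s ∷ p) (t ∷ q) (there x∈p─q) (there x∈q) = x∈p─q⇒x∉q p q x∈p─q x∈q

module _ {n : ℕ} where

  _≟ₛ_ : (p q : Subset n) → Dec (p ≡ q)
  _≟ₛ_ = ≡-dec _≟ᵇ_

  ⊈⇒∃∉ : {p q : Subset n} → ¬ p ⊆ q → ∃ λ x → x ∈ p × x ∉ q
  ⊈⇒∃∉ {p} {q} p⊈q with ¬∀⟶∃¬ n _ (λ x → x ∈? p →-dec x ∈? q) (λ p⊆q → p⊈q (p⊆q _))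
  ... | x , x∈p↛x∈q =
    x , decidable-stable (x ∈? p) (λ x∉p → x∈p↛x∈q (λ x∈p → contradiction x∈p x∉p)) ,
    λ x∈q → x∈p↛x∈q (λ _ → x∈q)

  ⊆∧≢⇒⊂ : {p q : Subset n} → p ⊆ q → p ≢ q → p ⊂ q
  ⊆∧≢⇒⊂ p⊆q p≢q with ⊈⇒∃∉ (λ q⊆p → p≢q (⊆-antisym p⊆q q⊆p))
  ... | x , x∈q , x∉p = p⊆q , x , x∈q , x∉p

  ⊂⇒≢ : {p q : Subset n} → p ⊂ q → p ≢ q
  ⊂⇒≢ p⊂q p≡q = ⊂-irref p≡q p⊂q

  ∪-lub : {p q r : Subset n} → p ⊆ r → q ⊆ r → p ∪ q ⊆ r
  ∪-lub {p} {q} p⊆r q⊆r x∈p∪q with x∈p∪q⁻ p q x∈p∪q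
  ... | inj₁ x∈p = p⊆r x∈p
  ... | inj₂ x∈q = q⊆r x∈q

  ∩-glb : {p q r : Subset n} → r ⊆ p → r ⊆ q → r ⊆ p ∩ q
  ∩-glb r⊆p r⊆q x∈r = x∈p∩q⁺ (r⊆p x∈r , r⊆q x∈r)

  ⁅x⁆⊆p : {x : Fin n} {p : Subset n} → x ∈ p → ⁅ x ⁆ ⊆ p
  ⁅x⁆⊆p {x} {p} x∈p y∈⁅x⁆ = subst (_∈ p) (sym (x∈⁅y⁆⇒x≡y x y∈⁅x⁆)) x∈p

  ∣p∣≡1⇒Nonempty : {p : Subset n} → ∣ p ∣ ≡ 1 → Nonempty p
  ∣p∣≡1⇒Nonempty {p} ∣p∣≡1 with nonempty? p
  ... | yes p-nonempty = p-nonempty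
  ... | no p-empty = contradiction (trans (sym (∣⊥∣≡0 n)) (subst (λ q → ∣ q ∣ ≡ 1) (Empty-unique p-empty) ∣p∣≡1)) λ ()

  ∣p∣≡1⇒x≡y : {p : Subset n} → ∣ p ∣ ≡ 1 → {x y : Fin n} → x ∈ p → y ∈ p → x ≡ y
  ∣p∣≡1⇒x≡y {p} ∣p∣≡1 {x} {y} x∈p y∈p = decidable-stable (x ≟ y) λ x≢y →
    ℕ.<-irrefl refl (begin-strict
      1             ≡⟨ sym (∣⁅x⁆∣≡1 y) ⟩
      ∣ ⁅ y ⁆ ∣     ≤⟨ p⊆q⇒∣p∣≤∣q∣ (⁅x⁆⊆p (x∈p∧x≢y⇒x∈p-y y∈p (x≢y ∘ sym))) ⟩
      ∣ p - x ∣     <⟨ x∈p⇒∣p-x∣<∣p∣ x∈p ⟩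
      ∣ p ∣         ≡⟨ ∣p∣≡1 ⟩
      1             ∎)
    where open ℕ.≤-Reasoning

  ∣p∣≢1⇒∃≢ : {p : Subset n} → ∣ p ∣ ≢ 1 → {x : Fin n} → x ∈ p → ∃ λ z → z ∈ p × z ≢ x
  ∣p∣≢1⇒∃≢ {p} ∣p∣≢1 {x} x∈p =
    let z , z∈p , z∉⁅x⁆ = ⊈⇒∃∉ p⊈⁅x⁆ in z , z∈p , x∉⁅y⁆⇒x≢y z∉⁅x⁆
    where
    p⊈⁅x⁆ : ¬ p ⊆ ⁅ x ⁆
    p⊈⁅x⁆ p⊆⁅x⁆ = ∣p∣≢1 (trans (cong ∣_∣ (⊆-antisym p⊆⁅x⁆ (⁅x⁆⊆p x∈p))) (∣⁅x⁆∣≡1 x))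

  ¬¬-⊂-maximal : {P : Subset n → Set} {p : Subset n} → P p →
                 ¬¬ (∃ λ q → P q × ∀ q' → P q' → ¬ q ⊂ q')
  ¬¬-⊂-maximal pp = do
    q , pq , maximal ← ¬¬-minimiser (λ q → ∣ ∁ q ∣) pp
    return (q , pq , λ q' pq' q⊂q' → maximal q' pq' (p⊂q⇒∣p∣<∣q∣ (p⊂q⇒∁p⊃∁q q⊂q')))

  ∈⋃⁺ : {x : Fin n} {p : Subset n} (ps : List (Subset n)) → p ∈ₗ ps → x ∈ p → x ∈ ⋃ ps
  ∈⋃⁺ (p ∷ ps) (Any.here refl) x∈p = x∈p∪q⁺ (inj₁ x∈p)
  ∈⋃⁺ (q ∷ ps) (Any.there p∈ps) x∈p = x∈p∪q⁺ (inj₂ (∈⋃⁺ ps p∈ps x∈p))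

  ∈⋃⁻ : {x : Fin n} (ps : List (Subset n)) → x ∈ ⋃ ps → ∃ λ p → p ∈ₗ ps × x ∈ p
  ∈⋃⁻ [] x∈⊥ = contradiction x∈⊥ ∉⊥
  ∈⋃⁻ (p ∷ ps) x∈⋃ with x∈p∪q⁻ p (⋃ ps) x∈⋃
  ... | inj₁ x∈p = p , Any.here refl , x∈p
  ... | inj₂ x∈⋃ps = let q , q∈ps , x∈q = ∈⋃⁻ ps x∈⋃ps in q , Any.there q∈ps , x∈q

¬¬-comprehension : ∀ {n} (Q : Fin n → Set) → ¬¬ (∃ λ S → ∀ x → (x ∈ S → Q x) × (Q x → x ∈ S))
¬¬-comprehension {ℕ.zero} Q = return ([] , λ ())
¬¬-comprehension {ℕ.suc n} Q = do
  S , S≈Q ← ¬¬-comprehension (Q ∘ suc)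
  Q0? ← ¬¬-excluded-middle
  return (does Q0? ∷ S , λ where
    zero → at-zero Q0?
    (suc x) → (λ { (there x∈S) → proj₁ (S≈Q x) x∈S }) , there ∘ proj₂ (S≈Q x))
  where
  at-zero : {S : Subset n} (Q0? : Dec (Q zero)) → (zero ∈ does Q0? ∷ S → Q zero) × (Q zero → zero ∈ does Q0? ∷ S)
  at-zero (yes q0) = (λ _ → q0) , (λ _ → here)
  at-zero (no ¬q0) = (λ ()) , (λ q0 → contradiction q0 ¬q0)

-- Closure spaces

module _ {n : ℕ} (cl : ClosureOperator n) where
  open ClosureOperator cl

  φ-closed : ∀ X → Closed cl (φ X)
  φ-closed = idempotent

  ⊆φ : {X : Subset n} → X ⊆ φ X
  ⊆φ = extensive _

  φ-mono : {X Y : Subset n} → X ⊆ Y → φ X ⊆ φ Y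
  φ-mono = monotone _ _

  φ-least : {X D : Subset n} → Closed cl D → X ⊆ D → φ X ⊆ D
  φ-least {X} cD X⊆D = subst (φ X ⊆_) cD (φ-mono X⊆D)

  ∩-closed : {A B : Subset n} → Closed cl A → Closed cl B → Closed cl (A ∩ B)
  ∩-closed cA cB = ⊆-antisym (∩-glb (φ-least cA (p∩q⊆p _ _)) (φ-least cB (p∩q⊆q _ _))) ⊆φ

  φ⁅_⁆ : Fin n → Subset n
  φ⁅ x ⁆ = φ ⁅ x ⁆

  x∈φ⁅x⁆ : (x : Fin n) → x ∈ φ⁅ x ⁆
  x∈φ⁅x⁆ x = ⊆φ (x∈⁅x⁆ x)

  φ⁅x⁆⊆ : {D : Subset n} {x : Fin n} → Closed cl D → x ∈ D → φ⁅ x ⁆ ⊆ D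
  φ⁅x⁆⊆ cD x∈D = φ-least cD (⁅x⁆⊆p x∈D)

  ∈φᵇ⁺ : {X : Subset n} {a : Fin n} → a ∈ X → φ⁅ a ⁆ ⊆ φᵇ cl X
  ∈φᵇ⁺ {X} {a} a∈X = ∈⋃⁺ _ (∈-map⁺ φ⁅_⁆ (∈-filter⁺ (_∈? X) (∈-allFin a) a∈X))

  ∈φᵇ⁻ : {X : Subset n} {y : Fin n} → y ∈ φᵇ cl X → ∃ λ a → a ∈ X × y ∈ φ⁅ a ⁆
  ∈φᵇ⁻ {X} y∈φᵇX with ∈⋃⁻ _ y∈φᵇX
  ... | _ , φ⁅a⁆∈ , y∈φ⁅a⁆ with ∈-map⁻ φ⁅_⁆ φ⁅a⁆∈
  ... | a , a∈ , refl = a , proj₂ (∈-filter⁻ (_∈? X) {xs = allFin n} a∈) , y∈φ⁅a⁆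

  φ⁅_⁆⁻ : Fin n → Subset n
  φ⁅ x ⁆⁻ = φ⁅ x ⁆ ─ ⁅ x ⁆

  x∉φ⁅x⁆⁻ : (x : Fin n) → x ∉ φ⁅ x ⁆⁻
  x∉φ⁅x⁆⁻ x x∈φ⁅x⁆⁻ = x∈p─q⇒x∉q φ⁅ x ⁆ ⁅ x ⁆ x∈φ⁅x⁆⁻ (x∈⁅x⁆ x)

  ∈φ⁅x⁆⁻ : {x y : Fin n} → y ∈ φ⁅ x ⁆ → y ≢ x → y ∈ φ⁅ x ⁆⁻
  ∈φ⁅x⁆⁻ y∈φ⁅x⁆ y≢x = x∈p∧x∉q⇒x∈p─q y∈φ⁅x⁆ (x≢y⇒x∉⁅y⁆ y≢x)

  φᵇ-least : {X V : Subset n} → (∀ {a} → a ∈ X → φ⁅ a ⁆ ⊆ V) → φᵇ cl X ⊆ V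
  φᵇ-least φ⁅X⁆⊆V y∈φᵇX = let _ , a∈X , y∈φ⁅a⁆ = ∈φᵇ⁻ y∈φᵇX in φ⁅X⁆⊆V a∈X y∈φ⁅a⁆

  ⊆φᵇ : {X : Subset n} → X ⊆ φᵇ cl X
  ⊆φᵇ {X} {a} a∈X = ∈φᵇ⁺ a∈X (x∈φ⁅x⁆ a)

  φᵇ⊆φ : {X : Subset n} → φᵇ cl X ⊆ φ X
  φᵇ⊆φ {X} = φᵇ-least (φ⁅x⁆⊆ (φ-closed X) ∘ ⊆φ)

  φᵇ⊆⇒φ⊆ : {B W : Subset n} → φᵇ cl B ⊆ φᵇ cl W → φ B ⊆ φ W
  φᵇ⊆⇒φ⊆ φᵇB⊆φᵇW = φ-least (φ-closed _) (φᵇ⊆φ ∘ φᵇB⊆φᵇW ∘ ⊆φᵇ)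

  ¬closed⇒φ⊈ : {X : Subset n} → ¬ Closed cl X → ¬ φ X ⊆ X
  ¬closed⇒φ⊈ ¬cX φX⊆X = ¬cX (⊆-antisym φX⊆X ⊆φ)

  module _ {D C : Subset n} (D⋖C : Predecessor cl D C) where

    pred-closed : Closed cl D
    pred-closed = proj₁ (proj₂ D⋖C)

    pred⊂ : D ⊂ C
    pred⊂ = proj₁ (proj₂ (proj₂ D⋖C))

    pred⊆ : D ⊆ C
    pred⊆ = p⊂q⇒p⊆q pred⊂

    pred≢ : D ≢ C
    pred≢ = ⊂⇒≢ pred⊂

    ⊆pred⇒≢ : {X : Subset n} → X ⊆ D → X ≢ C
    ⊆pred⇒≢ X⊆D refl = pred≢ (⊆-antisym pred⊆ X⊆D)

    pred-cover : {F : Subset n} → Closed cl F → D ⊆ F → F ⊆ C → ¬ F ⊆ D → F ≡ C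
    pred-cover {F} cF D⊆F F⊆C F⊈D = decidable-stable (F ≟ₛ C) λ F≢C →
      let x , x∈F , x∉D = ⊈⇒∃∉ F⊈D in
      proj₂ (proj₂ (proj₂ D⋖C)) F cF (D⊆F , x , x∈F , x∉D) (⊆∧≢⇒⊂ F⊆C F≢C)

  preds-⊆⇒≡ : {C D D' : Subset n} → Predecessor cl D C → Predecessor cl D' C → D ⊆ D' → D ≡ D'
  preds-⊆⇒≡ {D = D} {D'} D⋖C D'⋖C D⊆D' = decidable-stable (D ≟ₛ D') λ D≢D' →
    pred≢ D'⋖C (pred-cover D⋖C (pred-closed D'⋖C) D⊆D' (pred⊆ D'⋖C) λ D'⊆D → D≢D' (⊆-antisym D⊆D' D'⊆D))

  preds-join : {C D D' : Subset n} → Predecessor cl D C → Predecessor cl D' C → D ≢ D' → φ (D ∪ D') ≡ C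
  preds-join {D = D} {D'} D⋖C D'⋖C D≢D' = pred-cover D⋖C (φ-closed _) (⊆φ ∘ p⊆p∪q D')
    (φ-least (proj₁ D⋖C) (∪-lub (pred⊆ D⋖C) (pred⊆ D'⋖C)))
    (λ φ[D∪D']⊆D → D≢D' (sym (preds-⊆⇒≡ D'⋖C D⋖C (φ[D∪D']⊆D ∘ ⊆φ ∘ q⊆p∪q D D'))))

  ¬¬-pred-above : {C D : Subset n} → Closed cl C → Closed cl D → D ⊆ C → D ≢ C →
                  ¬¬ (∃ λ E → Predecessor cl E C × D ⊆ E)
  ¬¬-pred-above {C} {D} cC cD D⊆C D≢C = do
    E , (cE , D⊆E , E⊆C , E≢C) , maximal ←
      ¬¬-⊂-maximal {P = λ E → Closed cl E × D ⊆ E × E ⊆ C × E ≢ C} (cD , ⊆-refl , D⊆C , D≢C)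
    -- ⊆-proofs returned from do-blocks are eta-expanded: Agda checks the returned tuple before
    -- it knows the block's result type, so a bare proof would get its implicit argument fixed.
    return (E , (cC , cE , ⊆∧≢⇒⊂ E⊆C E≢C , λ F cF E⊂F F⊂C →
                  maximal F (cF , (λ x∈D → p⊂q⇒p⊆q E⊂F (D⊆E x∈D)) , p⊂q⇒p⊆q F⊂C , ⊂⇒≢ F⊂C) E⊂F) ,
            λ {x} → D⊆E {x})

  ¬joinIrreducible⇒¬¬pred≢ : {C C₁ : Subset n} → Closed cl C → ¬ JoinIrreducible cl C → Predecessor cl C₁ C →
                             ¬¬ (∃ λ C₂ → Predecessor cl C₂ C × C₂ ≢ C₁)
  ¬joinIrreducible⇒¬¬pred≢ {C₁ = C₁} cC ¬ji C₁⋖C none =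
    ¬ji (cC , C₁ , C₁⋖C , λ D D⋖C → decidable-stable (D ≟ₛ C₁) λ D≢C₁ → none (D , D⋖C , D≢C₁))

  module _ {C S : Subset n} (isS : IsPredIntersection cl C S) where

    ⋂pred⊆pred : {D : Subset n} → Predecessor cl D C → S ⊆ D
    ⋂pred⊆pred D⋖C {x} x∈S = proj₁ (isS x) x∈S _ D⋖C

    ∈⋂pred : {x : Fin n} → (∀ D → Predecessor cl D C → x ∈ D) → x ∈ S
    ∈⋂pred {x} = proj₂ (isS x)

    ⋂pred-closed : Closed cl S
    ⋂pred-closed = ⊆-antisym (λ x∈φS → ∈⋂pred λ D D⋖C → φ-least (pred-closed D⋖C) (⋂pred⊆pred D⋖C) x∈φS) ⊆φ

  quasiClosed-φ⊆ : {P X : Subset n} → QuasiClosed cl P → X ⊆ P → φ X ⊆ φ P → φ X ≢ φ P → φ X ⊆ P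
  quasiClosed-φ⊆ qc X⊆P φX⊆φP φX≢φP = qc _ X⊆P (⊆∧≢⇒⊂ φX⊆φP φX≢φP)

  quasiClosed⇒¬¬essential : {P : Subset n} → QuasiClosed cl P → ¬ Closed cl P → ¬¬ Essential cl (φ P)
  quasiClosed⇒¬¬essential {P} qc ¬cP = do
    Q , (qcQ , φQ≡φP , ¬cQ) , minimal ←
      ¬¬-minimiser ∣_∣ {P = λ Q → QuasiClosed cl Q × φ Q ≡ φ P × ¬ Closed cl Q} (qc , refl , ¬cP)
    return (φ-closed P , Q , (¬cQ , qcQ , λ Q' qcQ' φQ'≡φQ Q'⊂Q →
              minimal Q' (qcQ' , trans φQ'≡φQ φQ≡φP , ¬closed Q' φQ'≡φQ Q'⊂Q) (p⊂q⇒∣p∣<∣q∣ Q'⊂Q)) ,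
            φQ≡φP)
    where
    ¬closed : ∀ {Q} Q' → φ Q' ≡ φ Q → Q' ⊂ Q → ¬ Closed cl Q'
    ¬closed Q' φQ'≡φQ (_ , x , x∈Q , x∉Q') cQ' = x∉Q' (subst (x ∈_) cQ' (subst (x ∈_) (sym φQ'≡φQ) (⊆φ x∈Q)))

  joinIrreducible-generator : {P : Subset n} → JoinIrreducible cl (φ P) → ∃ λ p → p ∈ P × φ⁅ p ⁆ ≡ φ P
  joinIrreducible-generator {P} (cC , C₀ , C₀⋖C , unique) =
    let p , p∈P , p∉C₀ = ⊈⇒∃∉ P⊈C₀ in
    p , p∈P , decidable-stable (φ⁅ p ⁆ ≟ₛ φ P) λ φ⁅p⁆≢C →
      ¬¬-pred-above cC (φ-closed _) (φ-mono (⁅x⁆⊆p p∈P)) φ⁅p⁆≢C λ (D , D⋖C , φ⁅p⁆⊆D) →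
        p∉C₀ (subst (p ∈_) (unique D D⋖C) (φ⁅p⁆⊆D (x∈φ⁅x⁆ p)))
    where
    P⊈C₀ : ¬ P ⊆ C₀
    P⊈C₀ P⊆C₀ = pred≢ C₀⋖C (⊆-antisym (pred⊆ C₀⋖C) (φ-least (pred-closed C₀⋖C) P⊆C₀))

  ¬¬-DGenerator : {W : Subset n} {x : Fin n} → x ∈ φ W → x ∉ φᵇ cl W →
                  ¬¬ (∃ λ B → DGenerator cl B x × φᵇ cl B ⊆ φᵇ cl W)
  ¬¬-DGenerator {W} {x} x∈φW x∉φᵇW = do
    B , (x∈φB , φᵇB⊆φᵇW) , minimal ←
      ¬¬-minimiser (λ B → ∣ φᵇ cl B ∣) {P = λ B → x ∈ φ B × φᵇ cl B ⊆ φᵇ cl W} (x∈φW , ⊆-refl)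
    return (B , (x∈φB , x∉φᵇW ∘ φᵇB⊆φᵇW , λ B' φᵇB'⊂φᵇB x∈φB' →
                  minimal B' (x∈φB' , φᵇB⊆φᵇW ∘ p⊂q⇒p⊆q φᵇB'⊂φᵇB) (p⊂q⇒∣p∣<∣q∣ φᵇB'⊂φᵇB)) ,
            λ {y} → φᵇB⊆φᵇW {y})

  EBaseClosed-φ : ∀ X → EBaseClosed cl (φ X)
  EBaseClosed-φ X = (λ a x _ x∈φ⁅a⁆ a∈φX → φ⁅x⁆⊆ (φ-closed X) a∈φX x∈φ⁅a⁆) ,
                    (λ A x ((x∈φA , _) , _) A⊆φX → φ-least (φ-closed X) A⊆φX x∈φA)

  EBaseClosed-φ⁅⁆⊆ : {Y : Subset n} {p : Fin n} → EBaseClosed cl Y → p ∈ Y → φ⁅ p ⁆ ⊆ Y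
  EBaseClosed-φ⁅⁆⊆ {p = p} (binary , _) p∈Y {x} x∈φ⁅p⁆ with x ≟ p
  ... | yes refl = p∈Y
  ... | no x≢p = binary p x x≢p x∈φ⁅p⁆ p∈Y

  module _ {C S : Subset n} (isS : IsPredIntersection cl C S)
           (singleton-gaps : ∀ D → Predecessor cl D C → ∣ D ─ S ∣ ≡ 1) where

    gap-unique : {D : Subset n} {w y : Fin n} → Predecessor cl D C →
                 w ∈ D → w ∉ S → y ∈ D → y ∉ S → w ≡ y
    gap-unique D⋖C w∈D w∉S y∈D y∉S =
      ∣p∣≡1⇒x≡y (singleton-gaps _ D⋖C) (x∈p∧x∉q⇒x∈p─q w∈D w∉S) (x∈p∧x∉q⇒x∈p─q y∈D y∉S)

    gap-determines-pred : {D D' : Subset n} {y : Fin n} → Predecessor cl D C → Predecessor cl D' C →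
                          y ∈ D → y ∈ D' → y ∉ S → D ≡ D'
    gap-determines-pred {D} {D'} D⋖C D'⋖C y∈D y∈D' y∉S = preds-⊆⇒≡ D⋖C D'⋖C D⊆D'
      where
      D⊆D' : D ⊆ D'
      D⊆D' {w} w∈D with w ∈? S
      ... | yes w∈S = ⋂pred⊆pred isS D'⋖C w∈S
      ... | no w∉S = subst (_∈ D') (sym (gap-unique D⋖C w∈D w∉S y∈D y∉S)) y∈D'

    DGenerator⇒EGenerator : {A : Subset n} {x : Fin n} → Closed cl C → x ∉ S →
                            DGenerator cl A x → φ A ⊆ C → EGenerator cl A x
    DGenerator⇒EGenerator {A} {x} cC x∉S A-gen φA⊆C = A-gen , λ B (x∈φB , x∉φᵇB , _) φB⊂φA →
      let φB⊂C = ⊂-⊆-trans φB⊂φA φA⊆C in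
      ¬¬-pred-above cC (φ-closed B) (p⊂q⇒p⊆q φB⊂C) (⊂⇒≢ φB⊂C) λ (D , D⋖C , φB⊆D) →
        x∉S (φ-least (⋂pred-closed isS) (B⊆S D⋖C x∉φᵇB (φB⊆D x∈φB) φB⊆D) x∈φB)
      where
      B⊆S : ∀ {B D} → Predecessor cl D C → x ∉ φᵇ cl B → x ∈ D → φ B ⊆ D → B ⊆ S
      B⊆S D⋖C x∉φᵇB x∈D φB⊆D {b} b∈B = decidable-stable (b ∈? S) λ b∉S →
        x∉φᵇB (∈φᵇ⁺ b∈B (subst (λ b → x ∈ φ⁅ b ⁆) (gap-unique D⋖C x∈D x∉S (φB⊆D (⊆φ b∈B)) b∉S) (x∈φ⁅x⁆ x)))

    gap-points-generate : {C₁ C₂ : Subset n} {x₁ x₂ : Fin n} → Closed cl C →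
                          Predecessor cl C₁ C → Predecessor cl C₂ C → C₁ ≢ C₂ →
                          x₁ ∈ C₁ ─ S → x₂ ∈ C₂ ─ S → φ (φ⁅ x₁ ⁆ ∪ φ⁅ x₂ ⁆) ≡ C
    gap-points-generate {C₁} {C₂} {x₁} {x₂} cC C₁⋖C C₂⋖C C₁≢C₂ x₁∈C₁─S x₂∈C₂─S =
      decidable-stable (_ ≟ₛ C) λ φ[x₁∪x₂]≢C →
        ¬¬-pred-above cC (φ-closed _) (φ-least cC (∪-lub (φ⁅x⁆⊆ cC (pred⊆ C₁⋖C x₁∈C₁)) (φ⁅x⁆⊆ cC (pred⊆ C₂⋖C x₂∈C₂))))
          φ[x₁∪x₂]≢C λ (D , D⋖C , φ[x₁∪x₂]⊆D) →
        C₁≢C₂ (trans (gap-determines-pred C₁⋖C D⋖C x₁∈C₁ (φ[x₁∪x₂]⊆D (⊆φ (p⊆p∪q _ (x∈φ⁅x⁆ x₁)))) x₁∉S)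
                     (gap-determines-pred D⋖C C₂⋖C (φ[x₁∪x₂]⊆D (⊆φ (q⊆p∪q _ _ (x∈φ⁅x⁆ x₂)))) x₂∈C₂ x₂∉S))
      where
      x₁∈C₁ : x₁ ∈ C₁
      x₁∈C₁ = p─q⊆p C₁ S x₁∈C₁─S
      x₁∉S : x₁ ∉ S
      x₁∉S = x∈p─q⇒x∉q C₁ S x₁∈C₁─S
      x₂∈C₂ : x₂ ∈ C₂
      x₂∈C₂ = p─q⊆p C₂ S x₂∈C₂─S
      x₂∉S : x₂ ∉ S
      x₂∉S = x∈p─q⇒x∉q C₂ S x₂∈C₂─S

  -- Modular closure spaces

  module _ (modular : ModularClosedLattice cl) where

    modular-cut : {A B D : Subset n} → Closed cl A → Closed cl B → Closed cl D →
                  A ⊆ D → D ⊆ φ (A ∪ B) → φ (A ∪ (B ∩ D)) ≡ D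
    modular-cut {A} {B} {D} cA cB cD A⊆D D⊆φ[A∪B] =
      trans (modular A B D cA cB cD A⊆D) (⊆-antisym (p∩q⊆q _ _) (∩-glb D⊆φ[A∪B] ⊆-refl))

    preds-meet-covered : {C Ca Cb T : Subset n} → Predecessor cl Ca C → Predecessor cl Cb C → Closed cl T →
                         Ca ∩ Cb ⊆ T → T ⊆ Ca → ¬ Ca ⊆ T → T ⊆ Cb
    preds-meet-covered {C} {Ca} {Cb} {T} Ca⋖C Cb⋖C cT Ca∩Cb⊆T T⊆Ca Ca⊈T =
      decidable-stable (T ⊆? Cb) λ T⊈Cb → Ca⊈T (begin
        Ca                  ≡⟨ sym (modular-cut cT (pred-closed Cb⋖C) (pred-closed Ca⋖C) T⊆Ca (Ca⊆φ[T∪Cb] T⊈Cb)) ⟩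
        φ (T ∪ (Cb ∩ Ca))   ≤⟨ φ-least cT (∪-lub ⊆-refl (Ca∩Cb⊆T ∘ ⊆-reflexive (∩-comm Cb Ca))) ⟩
        T                   ∎)
      where
      open PosetReasoning (⊆-poset n)
      Ca⊆φ[T∪Cb] : ¬ T ⊆ Cb → Ca ⊆ φ (T ∪ Cb)
      Ca⊆φ[T∪Cb] T⊈Cb = subst (Ca ⊆_) (sym (pred-cover Cb⋖C (φ-closed _) (⊆φ ∘ q⊆p∪q T Cb)
        (φ-least (proj₁ Cb⋖C) (∪-lub (pred⊆ Ca⋖C ∘ T⊆Ca) (pred⊆ Cb⋖C)))
        (λ φ[T∪Cb]⊆Cb → T⊈Cb (φ[T∪Cb]⊆Cb ∘ ⊆φ ∘ p⊆p∪q Cb)))) (pred⊆ Ca⋖C)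

    quasiClosed-pred⊆ : {P D A B : Subset n} → QuasiClosed cl P → Predecessor cl D (φ P) →
                        Closed cl A → Closed cl B → A ⊆ D → A ⊆ P → B ⊆ P → φ P ⊆ φ (A ∪ B) → D ⊆ P
    quasiClosed-pred⊆ {P} {D} {A} {B} qc D⋖φP cA cB A⊆D A⊆P B⊆P φP⊆φ[A∪B] =
      subst (_⊆ P) D-generated
        (quasiClosed-φ⊆ qc (∪-lub A⊆P (B⊆P ∘ p∩q⊆p B D))
          (subst (_⊆ φ P) (sym D-generated) (pred⊆ D⋖φP)) (subst (_≢ φ P) (sym D-generated) (pred≢ D⋖φP)))
      where
      D-generated : φ (A ∪ (B ∩ D)) ≡ D
      D-generated = modular-cut cA cB (pred-closed D⋖φP) A⊆D (φP⊆φ[A∪B] ∘ pred⊆ D⋖φP)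

    module _ {P : Subset n} (qc : QuasiClosed cl P) where

      outside∩inside⊆inside : {Cu Cv Cl : Subset n} → Predecessor cl Cu (φ P) → Predecessor cl Cl (φ P) →
                              Cu ⊆ P → Cv ⊆ P → ¬ Cl ⊆ P → Cl ∩ Cv ⊆ Cu
      outside∩inside⊆inside {Cu} {Cv} {Cl} Cu⋖φP Cl⋖φP Cu⊆P Cv⊆P Cl⊈P = T⊆Cu ∘ ⊆φ ∘ q⊆p∪q (Cl ∩ Cu) (Cl ∩ Cv)
        where
        T : Subset n
        T = φ ((Cl ∩ Cu) ∪ (Cl ∩ Cv))
        T⊆Cl : T ⊆ Cl
        T⊆Cl = φ-least (pred-closed Cl⋖φP) (∪-lub (p∩q⊆p _ _) (p∩q⊆p _ _))
        T⊆P : T ⊆ P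
        T⊆P = quasiClosed-φ⊆ qc (∪-lub (Cu⊆P ∘ p∩q⊆q _ _) (Cv⊆P ∘ p∩q⊆q _ _)) (pred⊆ Cl⋖φP ∘ T⊆Cl) (⊆pred⇒≢ Cl⋖φP T⊆Cl)
        T⊆Cu : T ⊆ Cu
        T⊆Cu = preds-meet-covered Cl⋖φP Cu⋖φP (φ-closed _) (⊆φ ∘ p⊆p∪q _) T⊆Cl (λ Cl⊆T → Cl⊈P (T⊆P ∘ Cl⊆T))

      inside∩inside⊆outside : {Cu Cv Cl : Subset n} → Predecessor cl Cu (φ P) → Predecessor cl Cv (φ P) →
                              Predecessor cl Cl (φ P) → Cu ⊆ P → Cv ⊆ P → ¬ Cl ⊆ P → Cu ≢ Cv → Cu ∩ Cv ⊆ Cl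
      inside∩inside⊆outside {Cu} {Cv} {Cl} Cu⋖φP Cv⋖φP Cl⋖φP Cu⊆P Cv⊆P Cl⊈P Cu≢Cv = T⊆Cl ∘ ⊆φ ∘ q⊆p∪q (Cu ∩ Cl) (Cu ∩ Cv)
        where
        T : Subset n
        T = φ ((Cu ∩ Cl) ∪ (Cu ∩ Cv))
        T⊆Cv : T ⊆ Cv
        T⊆Cv = φ-least (pred-closed Cv⋖φP)
          (∪-lub (outside∩inside⊆inside Cv⋖φP Cl⋖φP Cv⊆P Cu⊆P Cl⊈P ∘ ⊆-reflexive (∩-comm Cu Cl)) (p∩q⊆q _ _))
        T⊆Cl : T ⊆ Cl
        T⊆Cl = preds-meet-covered Cu⋖φP Cl⋖φP (φ-closed _) (⊆φ ∘ p⊆p∪q _)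
          (φ-least (pred-closed Cu⋖φP) (∪-lub (p∩q⊆p _ _) (p∩q⊆p _ _)))
          (λ Cu⊆T → Cu≢Cv (preds-⊆⇒≡ Cu⋖φP Cv⋖φP (T⊆Cv ∘ Cu⊆T)))

      module _ {Ci Cj Cl : Subset n} (Ci⋖φP : Predecessor cl Ci (φ P)) (Cj⋖φP : Predecessor cl Cj (φ P))
               (Ci≢Cj : Ci ≢ Cj) (Ci⊆P : Ci ⊆ P) (Cj⊆P : Cj ⊆ P)
               (Cl⋖φP : Predecessor cl Cl (φ P)) (Cl⊈P : ¬ Cl ⊆ P) where

        inside-meet⊆pred : {Ca Cb Cm : Subset n} → Predecessor cl Ca (φ P) → Predecessor cl Cb (φ P) →
                           Predecessor cl Cm (φ P) → Ca ⊆ P → Ca ≢ Cb → Ca ∩ Cb ⊆ Cm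
        inside-meet⊆pred {Ca} {Cb} {Cm} Ca⋖φP Cb⋖φP Cm⋖φP Ca⊆P Ca≢Cb with Cb ⊆? P | Cm ⊆? P
        ... | yes Cb⊆P | no Cm⊈P = inside∩inside⊆outside Ca⋖φP Cb⋖φP Cm⋖φP Ca⊆P Cb⊆P Cm⊈P Ca≢Cb
        ... | yes Cb⊆P | yes Cm⊆P = λ y∈Ca∩Cb →
          outside∩inside⊆inside Cm⋖φP Cl⋖φP Cm⊆P Cb⊆P Cl⊈P
            (x∈p∩q⁺ (inside∩inside⊆outside Ca⋖φP Cb⋖φP Cl⋖φP Ca⊆P Cb⊆P Cl⊈P Ca≢Cb y∈Ca∩Cb , p∩q⊆q _ _ y∈Ca∩Cb))
        ... | no Cb⊈P | yes Cm⊆P =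
          outside∩inside⊆inside Cm⋖φP Cb⋖φP Cm⊆P Ca⊆P Cb⊈P ∘ ⊆-reflexive (∩-comm Ca Cb)
        ... | no Cb⊈P | no Cm⊈P = λ y∈Ca∩Cb →
          let y∈Cb∩Ca = ⊆-reflexive (∩-comm Ca Cb) y∈Ca∩Cb in
          inside∩inside⊆outside Ci⋖φP Cj⋖φP Cm⋖φP Ci⊆P Cj⊆P Cm⊈P Ci≢Cj
            (x∈p∩q⁺ (outside∩inside⊆inside Ci⋖φP Cb⋖φP Ci⊆P Ca⊆P Cb⊈P y∈Cb∩Ca ,
                     outside∩inside⊆inside Cj⋖φP Cb⋖φP Cj⊆P Ca⊆P Cb⊈P y∈Cb∩Ca))

        meet-partner : {S C' : Subset n} → IsPredIntersection cl (φ P) S → Predecessor cl C' (φ P) →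
                       ∃ λ Cb → Predecessor cl Cb (φ P) × Cb ≢ C' × C' ∩ Cb ⊆ S
        meet-partner {C' = C'} isS C'⋖φP with C' ≟ₛ Ci
        ... | yes refl = Cj , Cj⋖φP , Ci≢Cj ∘ sym , λ y∈Ci∩Cj →
          ∈⋂pred isS λ D D⋖φP → inside-meet⊆pred Ci⋖φP Cj⋖φP D⋖φP Ci⊆P Ci≢Cj y∈Ci∩Cj
        ... | no C'≢Ci = Ci , Ci⋖φP , C'≢Ci ∘ sym , λ y∈C'∩Ci →
          ∈⋂pred isS λ D D⋖φP → inside-meet⊆pred Ci⋖φP C'⋖φP D⋖φP Ci⊆P (C'≢Ci ∘ sym) (⊆-reflexive (∩-comm C' Ci) y∈C'∩Ci)

  -- Standard closure spaces

  module _ (standard : Standard cl) where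

    φ⁅x⁆⁻⋖φ⁅x⁆ : (x : Fin n) → Predecessor cl φ⁅ x ⁆⁻ φ⁅ x ⁆
    φ⁅x⁆⁻⋖φ⁅x⁆ x = φ-closed _ , standard x , (p─q⊆p _ _ , x , x∈φ⁅x⁆ x , x∉φ⁅x⁆⁻ x) , maximal
      where
      maximal : ∀ F → Closed cl F → φ⁅ x ⁆⁻ ⊂ F → ¬ F ⊂ φ⁅ x ⁆
      maximal F cF (_ , y , y∈F , y∉φ⁅x⁆⁻) (F⊆φ⁅x⁆ , z , z∈φ⁅x⁆ , z∉F) with x ∈? F
      ... | yes x∈F = z∉F (φ⁅x⁆⊆ cF x∈F z∈φ⁅x⁆)
      ... | no x∉F = y∉φ⁅x⁆⁻ (∈φ⁅x⁆⁻ (F⊆φ⁅x⁆ y∈F) λ { refl → x∉F y∈F })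

    φ⁅x⁆-joinIrreducible : (x : Fin n) → JoinIrreducible cl φ⁅ x ⁆
    φ⁅x⁆-joinIrreducible x = φ-closed _ , φ⁅ x ⁆⁻ , φ⁅x⁆⁻⋖φ⁅x⁆ x , λ D D⋖φ⁅x⁆ →
      preds-⊆⇒≡ D⋖φ⁅x⁆ (φ⁅x⁆⁻⋖φ⁅x⁆ x) λ y∈D → ∈φ⁅x⁆⁻ (pred⊆ D⋖φ⁅x⁆ y∈D) λ { refl → x∉pred D⋖φ⁅x⁆ y∈D }
      where
      x∉pred : ∀ {D} → Predecessor cl D φ⁅ x ⁆ → x ∉ D
      x∉pred D⋖φ⁅x⁆ x∈D = pred≢ D⋖φ⁅x⁆ (⊆-antisym (pred⊆ D⋖φ⁅x⁆) (φ⁅x⁆⊆ (pred-closed D⋖φ⁅x⁆) x∈D))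

    ∅-closed : Closed cl ∅
    ∅-closed = ⊆-antisym (λ {x} x∈φ∅ → contradiction (φ-least (standard x) ⊥⊆ x∈φ∅) (x∉φ⁅x⁆⁻ x)) ⊆φ

    ¬joinIrreducible⇒φ⁅x⁆≢ : {C : Subset n} → ¬ JoinIrreducible cl C → (x : Fin n) → φ⁅ x ⁆ ≢ C
    ¬joinIrreducible⇒φ⁅x⁆≢ ¬ji x refl = ¬ji (φ⁅x⁆-joinIrreducible x)

    ¬¬-pred∋ : {C : Subset n} {x : Fin n} → Closed cl C → ¬ JoinIrreducible cl C → x ∈ C →
               ¬¬ (∃ λ D → Predecessor cl D C × x ∈ D)
    ¬¬-pred∋ {x = x} cC ¬ji x∈C = do
      D , D⋖C , φ⁅x⁆⊆D ← ¬¬-pred-above cC (φ-closed _) (φ⁅x⁆⊆ cC x∈C) (¬joinIrreducible⇒φ⁅x⁆≢ ¬ji x)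
      return (D , D⋖C , φ⁅x⁆⊆D (x∈φ⁅x⁆ x))

    quasiClosed-φ⁅⁆⊆ : {P : Subset n} {p : Fin n} → QuasiClosed cl P → ¬ JoinIrreducible cl (φ P) →
                       p ∈ P → φ⁅ p ⁆ ⊆ P
    quasiClosed-φ⁅⁆⊆ {P} {p} qc ¬ji p∈P = quasiClosed-φ⊆ qc (⁅x⁆⊆p p∈P) (φ-mono (⁅x⁆⊆p p∈P)) (¬joinIrreducible⇒φ⁅x⁆≢ ¬ji p)

  SingletonGaps : Set
  SingletonGaps = ∀ C → Essential cl C → ¬ JoinIrreducible cl C →
                  ∀ C' → Predecessor cl C' C → ∀ S → IsPredIntersection cl C S → ∣ C' ─ S ∣ ≡ 1

  module _ (standard : Standard cl) (modular : ModularClosedLattice cl) where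

    -- The condition is sufficient

    module MinimalCounterexample {Y Z : Subset n} (eY : EBaseClosed cl Y) (Z⊆Y : Z ⊆ Y) (φZ⊈Y : ¬ φ Z ⊆ Y)
                  (minimal : ∀ Z' → Z' ⊆ Y × ¬ φ Z' ⊆ Y → ¬ ∣ φ Z' ∣ < ∣ φ Z ∣) where

      P : Subset n
      P = φ Z ∩ Y

      φP≡φZ : φ P ≡ φ Z
      φP≡φZ = ⊆-antisym (φ-least (φ-closed Z) (p∩q⊆p _ _)) (φ-mono (∩-glb ⊆φ Z⊆Y))

      P-¬closed : ¬ Closed cl P
      P-¬closed φP≡P = φZ⊈Y λ y∈φZ → p∩q⊆q _ _ (subst (_ ∈_) (trans (sym φP≡φZ) φP≡P) y∈φZ)

      P-quasiClosed : QuasiClosed cl P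
      P-quasiClosed X X⊆P φX⊂φP = ∩-glb (subst (φ X ⊆_) φP≡φZ (p⊂q⇒p⊆q φX⊂φP)) φX⊆Y
        where
        φX⊆Y : φ X ⊆ Y
        φX⊆Y = decidable-stable (φ X ⊆? Y) λ φX⊈Y →
          minimal X (p∩q⊆q _ _ ∘ X⊆P , φX⊈Y) (subst (λ E → ∣ φ X ∣ < ∣ E ∣) φP≡φZ (p⊂q⇒∣p∣<∣q∣ φX⊂φP))

      φP-¬joinIrreducible : ¬ JoinIrreducible cl (φ P)
      φP-¬joinIrreducible ji =
        let p , p∈P , φ⁅p⁆≡φP = joinIrreducible-generator ji in
        φZ⊈Y λ y∈φZ → EBaseClosed-φ⁅⁆⊆ eY (p∩q⊆q _ _ p∈P) (subst (_ ∈_) (sym (trans φ⁅p⁆≡φP φP≡φZ)) y∈φZ)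

      module _ {S : Subset n} (isS : IsPredIntersection cl (φ P) S)
               (singleton-gaps : ∀ D → Predecessor cl D (φ P) → ∣ D ─ S ∣ ≡ 1) where

        gap⊆P : {x : Fin n} → x ∈ φ P → x ∉ S → x ∈ P
        gap⊆P {x} x∈φP x∉S = decidable-stable (x ∈? P) λ x∉P →
          ¬¬-DGenerator x∈φP (x∉P ∘ φᵇP⊆P) λ (A , A-gen , φᵇA⊆φᵇP) →
            let A-egen = DGenerator⇒EGenerator isS singleton-gaps (φ-closed P) x∉S A-gen (φ-mono (A⊆P φᵇA⊆φᵇP)) in
            x∉P (x∈p∩q⁺ (subst (x ∈_) φP≡φZ x∈φP , proj₂ eY A x A-egen (p∩q⊆q _ _ ∘ A⊆P φᵇA⊆φᵇP)))
          where
          φᵇP⊆P : φᵇ cl P ⊆ P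
          φᵇP⊆P = φᵇ-least (quasiClosed-φ⁅⁆⊆ standard P-quasiClosed φP-¬joinIrreducible)
          A⊆P : ∀ {A} → φᵇ cl A ⊆ φᵇ cl P → A ⊆ P
          A⊆P φᵇA⊆φᵇP = φᵇP⊆P ∘ φᵇA⊆φᵇP ∘ ⊆φᵇ

        pred⊆P : {C₁ C₂ : Subset n} → Predecessor cl C₁ (φ P) → Predecessor cl C₂ (φ P) → C₁ ≢ C₂ → C₁ ⊆ P
        pred⊆P {C₁} {C₂} C₁⋖φP C₂⋖φP C₁≢C₂ =
          let x₁ , x₁∈C₁─S = ∣p∣≡1⇒Nonempty (singleton-gaps _ C₁⋖φP)
              x₂ , x₂∈C₂─S = ∣p∣≡1⇒Nonempty (singleton-gaps _ C₂⋖φP)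
          in quasiClosed-pred⊆ modular P-quasiClosed C₁⋖φP (φ-closed _) (φ-closed _)
               (φ⁅x⁆⊆ (pred-closed C₁⋖φP) (p─q⊆p C₁ S x₁∈C₁─S))
               (φ⁅gap⁆⊆P C₁⋖φP x₁∈C₁─S) (φ⁅gap⁆⊆P C₂⋖φP x₂∈C₂─S)
               (⊆-reflexive (sym (gap-points-generate isS singleton-gaps (φ-closed P) C₁⋖φP C₂⋖φP C₁≢C₂ x₁∈C₁─S x₂∈C₂─S)))
          where
          φ⁅gap⁆⊆P : ∀ {D x} → Predecessor cl D (φ P) → x ∈ D ─ S → φ⁅ x ⁆ ⊆ P
          φ⁅gap⁆⊆P {D} D⋖φP x∈D─S = quasiClosed-φ⁅⁆⊆ standard P-quasiClosed φP-¬joinIrreducible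
            (gap⊆P (pred⊆ D⋖φP (p─q⊆p D S x∈D─S)) (x∈p─q⇒x∉q D S x∈D─S))

        φP⊆P : {C₁ C₂ : Subset n} → Predecessor cl C₁ (φ P) → Predecessor cl C₂ (φ P) → C₁ ≢ C₂ → φ P ⊆ P
        φP⊆P C₁⋖φP C₂⋖φP C₁≢C₂ {y} y∈φP with y ∈? S
        ... | yes y∈S = pred⊆P C₁⋖φP C₂⋖φP C₁≢C₂ (⋂pred⊆pred isS C₁⋖φP y∈S)
        ... | no y∉S = gap⊆P y∈φP y∉S

      ¬¬P-closed : SingletonGaps → ¬¬ Closed cl P
      ¬¬P-closed singleton-gaps = do
        let x , x∈φP , _ = ⊈⇒∃∉ (¬closed⇒φ⊈ P-¬closed)
        φP-essential ← quasiClosed⇒¬¬essential P-quasiClosed P-¬closed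
        S , isS ← ¬¬-comprehension _
        C₁ , C₁⋖φP , _ ← ¬¬-pred∋ standard (φ-closed P) φP-¬joinIrreducible x∈φP
        C₂ , C₂⋖φP , C₂≢C₁ ← ¬joinIrreducible⇒¬¬pred≢ (φ-closed P) φP-¬joinIrreducible C₁⋖φP
        return (⊆-antisym (φP⊆P isS (λ D D⋖φP → singleton-gaps _ φP-essential φP-¬joinIrreducible D D⋖φP S isS)
                                C₁⋖φP C₂⋖φP (C₂≢C₁ ∘ sym))
                          ⊆φ)

    EBaseClosed⇒φ⊆ : SingletonGaps → {Y : Subset n} → EBaseClosed cl Y → φ Y ⊆ Y
    EBaseClosed⇒φ⊆ singleton-gaps {Y} eY = decidable-stable (φ Y ⊆? Y) λ φY⊈Y →
      ¬¬-minimiser (λ Z → ∣ φ Z ∣) {P = λ Z → Z ⊆ Y × ¬ φ Z ⊆ Y} (⊆-refl , φY⊈Y)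
        λ (Z , (Z⊆Y , φZ⊈Y) , minimal) → let open MinimalCounterexample eY Z⊆Y φZ⊈Y minimal in
          P-¬closed (decidable-stable (φ P ≟ₛ P) (¬¬P-closed singleton-gaps))

    SingletonGaps⇒EBaseValid : SingletonGaps → EBaseValid cl
    SingletonGaps⇒EBaseValid singleton-gaps X =
      (⊆φ , EBaseClosed-φ X) , λ Y X⊆Y eY → EBaseClosed⇒φ⊆ singleton-gaps eY ∘ φ-mono X⊆Y

    -- The condition is necessary

    module _ {P : Subset n} (qc : QuasiClosed cl P) (¬ji : ¬ JoinIrreducible cl (φ P)) where

      maximal-closed-generates : {D : Subset n} {p : Fin n} → Closed cl D → D ⊆ P →
                                 (∀ D' → Closed cl D' × D' ⊆ P → ¬ D ⊂ D') → p ∈ P → p ∉ D →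
                                 φ (D ∪ φ⁅ p ⁆) ≡ φ P
      maximal-closed-generates {D} {p} cD D⊆P maximal p∈P p∉D = decidable-stable (_ ≟ₛ φ P) λ φ[D∪φ⁅p⁆]≢φP →
        maximal _ (φ-closed _ , quasiClosed-φ⊆ qc D∪φ⁅p⁆⊆P (φ-mono D∪φ⁅p⁆⊆P) φ[D∪φ⁅p⁆]≢φP)
          (⊆φ ∘ p⊆p∪q _ , p , ⊆φ (q⊆p∪q D _ (x∈φ⁅x⁆ p)) , p∉D)
        where
        D∪φ⁅p⁆⊆P : D ∪ φ⁅ p ⁆ ⊆ P
        D∪φ⁅p⁆⊆P = ∪-lub D⊆P (quasiClosed-φ⁅⁆⊆ standard qc ¬ji p∈P)

      ¬¬-two-preds⊆ : ¬ Closed cl P →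
                      ¬¬ (∃₂ λ Ci Cj → Predecessor cl Ci (φ P) × Predecessor cl Cj (φ P) × Ci ≢ Cj × Ci ⊆ P × Cj ⊆ P)
      ¬¬-two-preds⊆ ¬cP = do
        D , (cD , D⊆P) , maximal ← ¬¬-⊂-maximal {P = λ D → Closed cl D × D ⊆ P} (∅-closed standard , ⊥⊆)
        let p , p∈P , p∉D = ⊈⇒∃∉ λ P⊆D → ¬closed⇒φ⊈ ¬cP (D⊆P ∘ φ-least cD P⊆D)
            φ⁅p⁆⊆P : φ⁅ p ⁆ ⊆ P
            φ⁅p⁆⊆P = quasiClosed-φ⁅⁆⊆ standard qc ¬ji p∈P
            generated : φ (D ∪ φ⁅ p ⁆) ≡ φ P
            generated = maximal-closed-generates cD D⊆P maximal p∈P p∉D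
        Ci , Ci⋖φP , D⊆Ci ← ¬¬-pred-above (φ-closed P) cD (⊆φ ∘ D⊆P) λ D≡φP → ¬closed⇒φ⊈ ¬cP (subst (_⊆ P) D≡φP D⊆P)
        Cj , Cj⋖φP , φ⁅p⁆⊆Cj ← ¬¬-pred-above (φ-closed P) (φ-closed _) (φ-mono (⁅x⁆⊆p p∈P)) (¬joinIrreducible⇒φ⁅x⁆≢ standard ¬ji p)
        let Ci⊆P : Ci ⊆ P
            Ci⊆P = quasiClosed-pred⊆ modular qc Ci⋖φP cD (φ-closed _) D⊆Ci D⊆P φ⁅p⁆⊆P (⊆-reflexive (sym generated))
            Cj⊆P : Cj ⊆ P
            Cj⊆P = quasiClosed-pred⊆ modular qc Cj⋖φP (φ-closed _) cD φ⁅p⁆⊆Cj φ⁅p⁆⊆P D⊆P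
                     (⊆-reflexive (trans (sym generated) (cong φ (∪-comm D φ⁅ p ⁆))))
            Ci≢Cj : Ci ≢ Cj
            Ci≢Cj Ci≡Cj = ⊆pred⇒≢ Ci⋖φP (subst (_⊆ Ci) generated
                            (φ-least (pred-closed Ci⋖φP) (∪-lub D⊆Ci (subst (φ⁅ p ⁆ ⊆_) (sym Ci≡Cj) φ⁅p⁆⊆Cj)))) refl
        return (Ci , Cj , Ci⋖φP , Cj⋖φP , Ci≢Cj , (λ {x} → Ci⊆P {x}) , λ {x} → Cj⊆P {x})

    module _ {C S C' Cb : Subset n} (cC : Closed cl C) (isS : IsPredIntersection cl C S)
             (C'⋖C : Predecessor cl C' C) (Cb⋖C : Predecessor cl Cb C) (Cb≢C' : Cb ≢ C') (C'∩Cb⊆S : C' ∩ Cb ⊆ S) where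

      C'∩pred⊆⋂pred : {Cm : Subset n} → Predecessor cl Cm C → Cm ≢ C' → C' ∩ Cm ⊆ S
      C'∩pred⊆⋂pred {Cm} Cm⋖C Cm≢C' y∈C'∩Cm = C'∩Cb⊆S (x∈p∩q⁺ (p∩q⊆p _ _ y∈C'∩Cm , C'∩Cm⊆Cb y∈C'∩Cm))
        where
        C'∩Cm⊆Cb : C' ∩ Cm ⊆ Cb
        C'∩Cm⊆Cb = preds-meet-covered modular C'⋖C Cb⋖C (∩-closed (pred-closed C'⋖C) (pred-closed Cm⋖C))
          (∩-glb (p∩q⊆p _ _) (⋂pred⊆pred isS Cm⋖C ∘ C'∩Cb⊆S)) (p∩q⊆p _ _)
          (λ C'⊆C'∩Cm → Cm≢C' (sym (preds-⊆⇒≡ C'⋖C Cm⋖C (p∩q⊆q _ _ ∘ C'⊆C'∩Cm))))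

      gap-pred : {Cm : Subset n} {y : Fin n} → y ∈ C' ─ S → Predecessor cl Cm C → y ∈ Cm → Cm ≡ C'
      gap-pred {Cm} y∈C'─S Cm⋖C y∈Cm = decidable-stable (Cm ≟ₛ C') λ Cm≢C' →
        x∈p─q⇒x∉q C' S y∈C'─S (C'∩pred⊆⋂pred Cm⋖C Cm≢C' (x∈p∩q⁺ (p─q⊆p C' S y∈C'─S , y∈Cm)))

      C'-covers-⋂pred : {X : Subset n} → Closed cl X → S ⊆ X → X ⊆ C' → ¬ X ⊆ S → C' ⊆ X
      C'-covers-⋂pred {X} cX S⊆X X⊆C' X⊈S = decidable-stable (C' ⊆? X) λ C'⊈X →
        X⊈S (C'∩Cb⊆S ∘ ∩-glb X⊆C' (preds-meet-covered modular C'⋖C Cb⋖C cX (S⊆X ∘ C'∩Cb⊆S) X⊆C' C'⊈X))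

      gap-antichain : {x z : Fin n} → x ∈ C' ─ S → z ∈ C' ─ S → z ≢ x → x ∉ φ⁅ z ⁆
      gap-antichain {x} {z} x∈C'─S z∈C'─S z≢x x∈φ⁅z⁆ =
        x∉φ⁅x⁆⁻ z (φ-least (standard z) X⊆φ⁅z⁆⁻ (subst (z ∈_) (sym X-modular) (x∈p∩q⁺ (z∈φ[x∪S] , x∈φ⁅x⁆ z))))
        where
        X-modular : φ (φ⁅ x ⁆ ∪ (S ∩ φ⁅ z ⁆)) ≡ φ (φ⁅ x ⁆ ∪ S) ∩ φ⁅ z ⁆
        X-modular = modular φ⁅ x ⁆ S φ⁅ z ⁆ (φ-closed _) (⋂pred-closed isS) (φ-closed _) (φ⁅x⁆⊆ (φ-closed _) x∈φ⁅z⁆)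
        z∈φ[x∪S] : z ∈ φ (φ⁅ x ⁆ ∪ S)
        z∈φ[x∪S] = C'-covers-⋂pred (φ-closed _) (⊆φ ∘ q⊆p∪q _ _)
          (φ-least (pred-closed C'⋖C) (∪-lub (φ⁅x⁆⊆ (pred-closed C'⋖C) (p─q⊆p C' S x∈C'─S)) (⋂pred⊆pred isS C'⋖C)))
          (λ φ[x∪S]⊆S → x∈p─q⇒x∉q C' S x∈C'─S (φ[x∪S]⊆S (⊆φ (p⊆p∪q _ (x∈φ⁅x⁆ x)))))
          (p─q⊆p C' S z∈C'─S)
        X⊆φ⁅z⁆⁻ : φ⁅ x ⁆ ∪ (S ∩ φ⁅ z ⁆) ⊆ φ⁅ z ⁆⁻
        X⊆φ⁅z⁆⁻ = ∪-lub (φ⁅x⁆⊆ (standard z) (∈φ⁅x⁆⁻ x∈φ⁅z⁆ (z≢x ∘ sym)))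
          λ y∈S∩φ⁅z⁆ → ∈φ⁅x⁆⁻ (p∩q⊆q _ _ y∈S∩φ⁅z⁆) λ { refl → x∈p─q⇒x∉q C' S z∈C'─S (p∩q⊆p _ _ y∈S∩φ⁅z⁆) }

      ¬¬-DGenerator⊆C' : {x z : Fin n} → x ∈ C' ─ S → z ∈ C' ─ S → z ≢ x →
                         ¬¬ (∃ λ B → DGenerator cl B x × φ B ⊆ C')
      ¬¬-DGenerator⊆C' {x} {z} x∈C'─S z∈C'─S z≢x = do
        B , B-gen , φᵇB⊆φᵇW ← ¬¬-DGenerator x∈φW x∉φᵇW
        return (B , B-gen , λ {y} → φW⊆C' {y} ∘ φᵇ⊆⇒φ⊆ φᵇB⊆φᵇW)
        where
        W : Subset n
        W = S ∪ ⁅ z ⁆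
        φW⊆C' : φ W ⊆ C'
        φW⊆C' = φ-least (pred-closed C'⋖C) (∪-lub (⋂pred⊆pred isS C'⋖C) (⁅x⁆⊆p (p─q⊆p C' S z∈C'─S)))
        x∈φW : x ∈ φ W
        x∈φW = C'-covers-⋂pred (φ-closed W) (⊆φ ∘ p⊆p∪q _) φW⊆C'
          (λ φW⊆S → x∈p─q⇒x∉q C' S z∈C'─S (φW⊆S (⊆φ (q⊆p∪q S _ (x∈⁅x⁆ z)))))
          (p─q⊆p C' S x∈C'─S)
        x∉φᵇW : x ∉ φᵇ cl W
        x∉φᵇW x∈φᵇW with ∈φᵇ⁻ x∈φᵇW
        ... | a , a∈W , x∈φ⁅a⁆ with x∈p∪q⁻ S ⁅ z ⁆ a∈W
        ... | inj₁ a∈S = x∈p─q⇒x∉q C' S x∈C'─S (φ⁅x⁆⊆ (⋂pred-closed isS) a∈S x∈φ⁅a⁆)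
        ... | inj₂ a∈⁅z⁆ = gap-antichain x∈C'─S z∈C'─S z≢x (subst (λ a → x ∈ φ⁅ a ⁆) (x∈⁅y⁆⇒x≡y z a∈⁅z⁆) x∈φ⁅a⁆)

      ∈C∖gap : {x : Fin n} → x ∈ C → x ∉ C' ─ S → x ∈ C ─ (C' ─ S)
      ∈C∖gap = x∈p∧x∉q⇒x∈p─q

      C∖gap∩C'⊆⋂pred : {a : Fin n} → a ∈ C ─ (C' ─ S) → a ∈ C' → a ∈ S
      C∖gap∩C'⊆⋂pred {a} a∈C∖gap a∈C' = decidable-stable (a ∈? S) λ a∉S →
        x∈p─q⇒x∉q C (C' ─ S) a∈C∖gap (x∈p∧x∉q⇒x∈p─q a∈C' a∉S)

      C∖gap-binaryClosed : ¬ JoinIrreducible cl C →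
                           ∀ a x → x ∈ φ⁅ a ⁆ → a ∈ C ─ (C' ─ S) → x ∈ C ─ (C' ─ S)
      C∖gap-binaryClosed ¬ji a x x∈φ⁅a⁆ a∈C∖gap = ∈C∖gap (φ⁅x⁆⊆ cC a∈C x∈φ⁅a⁆) λ x∈C'─S →
        ¬¬-pred∋ standard cC ¬ji a∈C λ (Cm , Cm⋖C , a∈Cm) →
          let a∈C' = subst (a ∈_) (gap-pred x∈C'─S Cm⋖C (φ⁅x⁆⊆ (pred-closed Cm⋖C) a∈Cm x∈φ⁅a⁆)) a∈Cm in
          x∈p─q⇒x∉q C' S x∈C'─S (φ⁅x⁆⊆ (⋂pred-closed isS) (C∖gap∩C'⊆⋂pred a∈C∖gap a∈C') x∈φ⁅a⁆)
        where
        a∈C : a ∈ C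
        a∈C = p─q⊆p C (C' ─ S) a∈C∖gap

      C∖gap-EGeneratorClosed : ∣ C' ─ S ∣ ≢ 1 →
                               ∀ A x → EGenerator cl A x → A ⊆ C ─ (C' ─ S) → x ∈ C ─ (C' ─ S)
      C∖gap-EGeneratorClosed gap≢1 A x ((x∈φA , _) , minimal) A⊆C∖gap = ∈C∖gap (φA⊆C x∈φA) λ x∈C'─S →
        case-generated x∈C'─S (φ A ≟ₛ C)
        where
        φA⊆C : φ A ⊆ C
        φA⊆C = φ-least cC (p─q⊆p C (C' ─ S) ∘ A⊆C∖gap)
        case-generated : x ∈ C' ─ S → Dec (φ A ≡ C) → ⊥
        case-generated x∈C'─S (yes φA≡C) =
          let z , z∈C'─S , z≢x = ∣p∣≢1⇒∃≢ gap≢1 x∈C'─S in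
          ¬¬-DGenerator⊆C' x∈C'─S z∈C'─S z≢x λ (B , B-gen , φB⊆C') →
            minimal B B-gen (subst (φ B ⊂_) (sym φA≡C) (⊆-⊂-trans φB⊆C' (pred⊂ C'⋖C)))
        case-generated x∈C'─S (no φA≢C) =
          ¬¬-pred-above cC (φ-closed A) φA⊆C φA≢C λ (Cm , Cm⋖C , φA⊆Cm) →
            let Cm≡C' = gap-pred x∈C'─S Cm⋖C (φA⊆Cm x∈φA) in
            x∈p─q⇒x∉q C' S x∈C'─S (φ-least (⋂pred-closed isS)
              (λ a∈A → C∖gap∩C'⊆⋂pred (A⊆C∖gap a∈A) (subst (_ ∈_) Cm≡C' (φA⊆Cm (⊆φ a∈A)))) x∈φA)

      C∖gap-EBaseClosed : ¬ JoinIrreducible cl C → ∣ C' ─ S ∣ ≢ 1 → EBaseClosed cl (C ─ (C' ─ S))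
      C∖gap-EBaseClosed ¬ji gap≢1 =
        (λ a x _ → C∖gap-binaryClosed ¬ji a x) , C∖gap-EGeneratorClosed gap≢1

      C∖gap-¬closed : {Cu Cv : Subset n} → Predecessor cl Cu C → Predecessor cl Cv C →
                      Cu ≢ Cv → Cu ≢ C' → Cv ≢ C' → ¬ φ (C ─ (C' ─ S)) ⊆ C ─ (C' ─ S)
      C∖gap-¬closed Cu⋖C Cv⋖C Cu≢Cv Cu≢C' Cv≢C' φ[C∖gap]⊆C∖gap =
        let y , y∈C' , y∉S = ⊈⇒∃∉ C'⊈S in
        x∈p─q⇒x∉q C (C' ─ S) (φ[C∖gap]⊆C∖gap (φ-mono (∪-lub (pred⊆C∖gap Cu⋖C Cu≢C') (pred⊆C∖gap Cv⋖C Cv≢C'))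
          (subst (y ∈_) (sym (preds-join Cu⋖C Cv⋖C Cu≢Cv)) (pred⊆ C'⋖C y∈C'))))
          (x∈p∧x∉q⇒x∈p─q y∈C' y∉S)
        where
        C'⊈S : ¬ C' ⊆ S
        C'⊈S C'⊆S = Cb≢C' (sym (preds-⊆⇒≡ C'⋖C Cb⋖C (⋂pred⊆pred isS Cb⋖C ∘ C'⊆S)))
        pred⊆C∖gap : {Cm : Subset n} → Predecessor cl Cm C → Cm ≢ C' → Cm ⊆ C ─ (C' ─ S)
        pred⊆C∖gap Cm⋖C Cm≢C' y∈Cm = ∈C∖gap (pred⊆ Cm⋖C y∈Cm) λ y∈C'─S → Cm≢C' (gap-pred y∈C'─S Cm⋖C y∈Cm)

    EBaseValid⇒SingletonGaps : EBaseValid cl → SingletonGaps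
    EBaseValid⇒SingletonGaps valid _ (cC , P , (¬cP , qc , _) , refl) ¬ji C' C'⋖C S isS =
      decidable-stable (∣ C' ─ S ∣ ℕ.≟ 1) λ gap≢1 →
      ¬¬-two-preds⊆ qc ¬ji ¬cP λ (Ci , Cj , Ci⋖C , Cj⋖C , Ci≢Cj , Ci⊆P , Cj⊆P) →
      let x , x∈φP , x∉P = ⊈⇒∃∉ (¬closed⇒φ⊈ ¬cP) in
      ¬¬-pred∋ standard cC ¬ji x∈φP λ (Cl , Cl⋖C , x∈Cl) →
      let Cl⊈P : ¬ Cl ⊆ P
          Cl⊈P Cl⊆P = x∉P (Cl⊆P x∈Cl)
          Cb , Cb⋖C , Cb≢C' , C'∩Cb⊆S = meet-partner modular qc Ci⋖C Cj⋖C Ci≢Cj Ci⊆P Cj⊆P Cl⋖C Cl⊈P isS C'⋖C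
          Cu , Cv , Cu⋖C , Cv⋖C , Cu≢Cv , Cu≢C' , Cv≢C' =
            two-avoiding _≟ₛ_ {R = λ D → Predecessor cl D (φ P)} Ci⋖C Cj⋖C Cl⋖C Ci≢Cj (λ { refl → Cl⊈P Ci⊆P }) (λ { refl → Cl⊈P Cj⊆P }) C'
      in C∖gap-¬closed cC isS C'⋖C Cb⋖C Cb≢C' C'∩Cb⊆S Cu⋖C Cv⋖C Cu≢Cv Cu≢C' Cv≢C'
           (proj₂ (valid _) _ ⊆-refl (C∖gap-EBaseClosed cC isS C'⋖C Cb⋖C Cb≢C' C'∩Cb⊆S ¬ji gap≢1))

theorem2 : {n : ℕ} (cl : ClosureOperator n) →
    Standard cl → ModularClosedLattice cl →
    EBaseValid cl ⇔
      (∀ C → Essential cl C → ¬ JoinIrreducible cl C →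
        ∀ C' → Predecessor cl C' C →
        ∀ S → IsPredIntersection cl C S → ∣ C' ─ S ∣ ≡ 1)
theorem2 cl standard modular =
  mk⇔ (EBaseValid⇒SingletonGaps cl standard modular) (SingletonGaps⇒EBaseValid cl standard modular)
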